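{- Given an interpretation of types, let $\Gamma\vdash r:\rho$ be a typed term, $\Gamma=(\rho_0,\dots,\rho_{n-1})$, and let $C=(i_0,\dots,i_{n-1})$ and $i\le i'$ in $I_\rho$ be such that the state judgements $r:C\vdash i$ and $r:C\vdash i'$ are derivable. Then for every $\vec a\in\llbracket\Gamma\rrbracket_C$ (with the values computed along any derivations of these judgements), $\llbracket r\rrbracket^{i'}_{\vec a:C}\rhd\llbracket r\rrbracket^i_{\vec a:C}$.
   Context: Factor systems: over a nonempty directed preorder $I$, sets $M_i$ with relations $\rhd\subseteq M_{i'}\times M_i$ ($i\le i'$, reflexive for $i=i'$); $a_i\approx b_j$ iff some $a_{i'}$ ($i'\ge i,j$) has $a_{i'}\rhd a_i$, $a_{i'}\rhd b_j$; prefactor: $a_{i'}\approx a_i\iff a_{i'}\rhd a_i$; a factor system is a prefactor system with $\approx$-preserving $\mathrm{emb}_{i,i'}:M_i\to M_{i'}$, $\mathrm{proj}_{i',i}:M_{i'}\to M_i$ ($i\le i'$) with $\mathrm{emb}_{i,i}(a)\approx a\approx\mathrm{proj}_{i,i}(a)$, composition laws up to $\approx$, $\mathrm{proj}_{i',i}\circ\mathrm{emb}_{i,i'}(a)\approx a$, and coherence $a_{i'}\rhd a_i\Rightarrow\mathrm{emb}_{i',i''}(a_{i'})\rhd a_i$, $a_{i''}\rhd a_i\Rightarrow\mathrm{proj}_{i'',i'}(a_{i''})\rhd a_i$. Direct: $a_{i'}\rhd a_i\iff a_{i'}\approx\mathrm{emb}_{i,i'}(a_i)$. Function space $[M_I\to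 N_J]$: index $I\times J$ (product order, written $i\to j$), $\approx$-preserving maps $M_i\to N_j$, $f'\rhd f$ iff ($a_{i'}\rhd a_i\Rightarrow f'(a_{i'})\rhd f(a_i)$), $\mathrm{emb}(f)=\mathrm{emb}_{j,j'}\circ f\circ\mathrm{proj}_{i',i}$, $\mathrm{proj}(f')=\mathrm{proj}_{j',j}\circ f'\circ\mathrm{emb}_{i,i'}$. A filter assignment gives for each index set $I$ a set $\mathcal F(I)$ of cofinal subsets, closed under supersets and finite intersections, containing all up-sets; Condition (D) is assumed: $H\in\mathcal F(I\times J)$, $I'\in\mathcal F(I)$ imply $\{j\mid\exists i\in I',\ i\to j\in H\}\in\mathcal F(J)$. A limit of a factor system: a set $M$ with a relation $a\rhd a_i$ ($a\in M$) such that $\{i\mid\exists a_i,\ a\rhd a_i\}\in\mathcal F(I)$, $a\rhd a_{i'},a\rhd a_i,i\le i'\Rightarrow a_{i'}\rhd a_i$, which is maximal, extensional and complete, and carries maps $\mathrm{Emb}_i:M_i\to M$ with $a_{i'}\rhd a_i\Rightarrow\mathrm{Emb}_{i'}(a_{i'})\rhd a_i$. Types: $\rho::=\iota\mid\rho\to\rho$, base types $\iota$ including $\mathrm{prop}$. Positive types $\rho^+::=\iota\mid\rho^-\to\rho^+$; negative types $\rho^-::=\mathrm{prop}\mid\rho^+\to\rho^-$. Each type has an index set $I_\rho$, $I_{\rho\to\sigma}=I_\rho\times I_\sigma$, $I_{\mathrm{prop}}=\{\mathrm{prop}\}$. An interpretation of types assigns to each type $\rho$ a factor system $(\llbracket\rho\rrbracket_i)_{i\in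 I_\rho}$ and a limit $\llbracket\rho\rrbracket$ such that: base type factor systems are direct; $\llbracket\mathrm{prop}\rrbracket_{\mathrm{prop}}=\llbracket\mathrm{prop}\rrbracket=\{true,false\}$ with $\rhd$ equality; $\rho\to\sigma$ gets the function space factor system and limit $[\llbracket\rho\rrbracket\to_{\mathcal F}\llbracket\sigma\rrbracket]$, the functions $f$ with $\{i\to j\mid\exists f_{i\to j},\ f\rhd f_{i\to j}\}\in\mathcal F(I_\rho\times I_\sigma)$, where $f\rhd f_{i\to j}$ iff $a\rhd a_i$ implies $f(a)\rhd f_{i\to j}(a_i)$. Terms: $r::=x_k\mid rr\mid\lambda x_k^\rho r$. Typing: $\Gamma\vdash x_k:\rho_k$ ($k<n$); $\Gamma\vdash r:\rho\to\sigma$, $\Gamma\vdash s:\rho$ give $\Gamma\vdash rs:\sigma$; $\Gamma.\rho\vdash r:\sigma$ gives $\Gamma\vdash\lambda x_n^\rho r:\rho\to\sigma$. State judgements $r:C\vdash i$ ($C\in I_{\rho_0}\times\dots\times I_{\rho_{n-1}}$, $i\in I_\rho$): (Var+) $\rho_k$ positive, $j\ge i_k$: $x_k:C\vdash j$; (Var$-$) $\rho_k$ negative, $j\le i_k$: $x_k:C\vdash j$; (App) from $r:C\vdash i\to j$, $s:C\vdash i$ infer $rs:C\vdash j$; (Abs) from $r:C.i\vdash j$ infer $\lambda x_n^\rho r:C\vdash i\to j$. State values for $\vec a\in\llbracket\Gamma\rrbracket_C:=\llbracket\rho_0\rrbracket_{i_0}\times\dots\times\llbracket\rho_{n-1}\rrbracket_{i_{n-1}}$,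 by recursion on the derivation: $\llbracket x_k\rrbracket^j_{\vec a:C}=\mathrm{emb}_{i_k,j}(a_k)$ if $\rho_k$ positive, $=\mathrm{proj}_{i_k,j}(a_k)$ if $\rho_k$ negative; $\llbracket rs\rrbracket^j_{\vec a:C}=\llbracket r\rrbracket^{i\to j}_{\vec a:C}(\llbracket s\rrbracket^i_{\vec a:C})$; $\llbracket\lambda x_n^\rho r\rrbracket^{i\to j}_{\vec a:C}$ is the map $b\mapsto\llbracket r\rrbracket^j_{\vec a.b:C.i}$. -}

module Defs where

open import Data.Product using (Σ; Σ-syntax; _×_; _,_; proj₁; proj₂)
open import Data.Unit using (⊤; tt)
open import Data.Bool using (Bool)
open import Relation.Binary.PropositionalEquality using (_≡_; refl; sym; trans; cong₂)
open import Function using (id; _∘_)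

-- The data of a (pre)factor system over an index preorder I.
-- The relation a_{i'} ▷ a_i is given for all pairs of levels, but it is
-- only ever used (in all laws and in ≈) when i ≤ i'.
record FSData : Set₁ where
  field
    Idx     : Set
    _≤_     : Idx → Idx → Set
    ≤-refl  : ∀ {i} → i ≤ i
    ≤-trans : ∀ {i j k} → i ≤ j → j ≤ k → i ≤ k
    M       : Idx → Set
    _▷_     : ∀ {i i'} → M i' → M i → Set
    emb     : ∀ {i i'} → i ≤ i' → M i → M i'
    proj    : ∀ {i i'} → i ≤ i' → M i' → M i

  _≈_ : ∀ {i j} → M i → M j → Set
  _≈_ {i} {j} a b =
    Σ[ k ∈ Idx ] Σ[ p ∈ i ≤ k ] Σ[ q ∈ j ≤ k ] Σ[ c ∈ M k ] ((c ▷ a) × (c ▷ b))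

record IsDirectedPreorder (D : FSData) : Set where
  open FSData D
  field
    ≤-irrelevant : ∀ {i j} (p q : i ≤ j) → p ≡ q
    inhabited    : Idx
    directed     : ∀ i j → Σ[ k ∈ Idx ] ((i ≤ k) × (j ≤ k))

record CoreLaws (D : FSData) : Set where
  open FSData D
  field
    ▷-refl    : ∀ {i} (a : M i) → a ▷ a
    prefactor : ∀ {i i'} → i ≤ i' → (a' : M i') (a : M i) →
                (a' ≈ a → a' ▷ a) × (a' ▷ a → a' ≈ a)
    emb-≈     : ∀ {i i'} (p : i ≤ i') {a b : M i} → a ≈ b → emb p a ≈ emb p b
    proj-≈    : ∀ {i i'} (p : i ≤ i') {a b : M i'} → a ≈ b → proj p a ≈ proj p b
    emb-coh   : ∀ {i i' i''} → i ≤ i' → (q : i' ≤ i'') {a' : M i'} {a : M i} →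
                a' ▷ a → emb q a' ▷ a
    proj-coh  : ∀ {i i' i''} → i ≤ i' → (q : i' ≤ i'') {a'' : M i''} {a : M i} →
                a'' ▷ a → proj q a'' ▷ a

record RestLaws (D : FSData) : Set where
  open FSData D
  field
    emb-id    : ∀ {i} (a : M i) → emb ≤-refl a ≈ a
    proj-id   : ∀ {i} (a : M i) → a ≈ proj ≤-refl a
    emb-comp  : ∀ {i i' i''} (p : i ≤ i') (q : i' ≤ i'') (a : M i) →
                emb q (emb p a) ≈ emb (≤-trans p q) a
    proj-comp : ∀ {i i' i''} (p : i ≤ i') (q : i' ≤ i'') (a : M i'') →
                proj p (proj q a) ≈ proj (≤-trans p q) a
    proj-emb  : ∀ {i i'} (p : i ≤ i') (a : M i) → proj p (emb p a) ≈ a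

record FactorSystem : Set₁ where
  field
    dat  : FSData
    pre  : IsDirectedPreorder dat
    core : CoreLaws dat
    rest : RestLaws dat

IsDirect : FSData → Set
IsDirect D = ∀ {i i'} (p : i ≤ i') (a' : M i') (a : M i) →
             (a' ▷ a → a' ≈ emb p a) × (a' ≈ emb p a → a' ▷ a)
  where open FSData D

-- A factor system together with the laws that are closed under the
-- function-space construction (used to build function spaces).
record CoreFS : Set₁ where
  field
    dat  : FSData
    pre  : IsDirectedPreorder dat
    core : CoreLaws dat

toCore : FactorSystem → CoreFS
toCore F = record { dat = FactorSystem.dat F ; pre = FactorSystem.pre F
                  ; core = FactorSystem.core F }

module FunSpace (A B : FSData) (PA : IsDirectedPreorder A) (PB : IsDirectedPreorder B)
                (LA : CoreLaws A) (LB : CoreLaws B) where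
  private
    module A = FSData A
    module B = FSData B
    module PA = IsDirectedPreorder PA
    module PB = IsDirectedPreorder PB
    module LA = CoreLaws LA
    module LB = CoreLaws LB

  Pres : ∀ {i j} → (A.M i → B.M j) → Set
  Pres f = ∀ {a b} → a A.≈ b → f a B.≈ f b

  funData : FSData
  funData = record
    { Idx     = A.Idx × B.Idx
    ; _≤_     = λ x y → (proj₁ x A.≤ proj₁ y) × (proj₂ x B.≤ proj₂ y)
    ; ≤-refl  = A.≤-refl , B.≤-refl
    ; ≤-trans = λ p q → A.≤-trans (proj₁ p) (proj₁ q) , B.≤-trans (proj₂ p) (proj₂ q)
    ; M       = λ x → Σ (A.M (proj₁ x) → B.M (proj₂ x)) Pres
    ; _▷_     = λ f' f → ∀ a' a → a' A.▷ a → proj₁ f' a' B.▷ proj₁ f a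
    ; emb     = λ p f → (B.emb (proj₂ p) ∘ proj₁ f ∘ A.proj (proj₁ p))
                      , (λ e → LB.emb-≈ (proj₂ p) (proj₂ f (LA.proj-≈ (proj₁ p) e)))
    ; proj    = λ p f → (B.proj (proj₂ p) ∘ proj₁ f ∘ A.emb (proj₁ p))
                      , (λ e → LB.proj-≈ (proj₂ p) (proj₂ f (LA.emb-≈ (proj₁ p) e)))
    }

  private module F = FSData funData

  funPre : IsDirectedPreorder funData
  funPre = record
    { ≤-irrelevant = λ p q → cong₂ _,_ (PA.≤-irrelevant (proj₁ p) (proj₁ q))
                                       (PB.≤-irrelevant (proj₂ p) (proj₂ q))
    ; inhabited = PA.inhabited , PB.inhabited
    ; directed = λ x y →
        let (k , p , q) = PA.directed (proj₁ x) (proj₁ y)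
            (l , r , s) = PB.directed (proj₂ x) (proj₂ y)
        in (k , l) , (p , r) , (q , s)
    }

  private
    reflF : ∀ {x} (f : F.M x) → f F.▷ f
    reflF f a' a r =
      proj₁ (LB.prefactor B.≤-refl _ _) (proj₂ f (proj₂ (LA.prefactor A.≤-refl _ _) r))

    pfF : ∀ {x x'} → x F.≤ x' → (f' : F.M x') (f : F.M x) →
          (f' F.≈ f → f' F.▷ f) × (f' F.▷ f → f' F.≈ f)
    pfF {x} {x'} p f' f = to , from
      where
      to : f' F.≈ f → f' F.▷ f
      to (k , q1 , q2 , h , hf' , hf) a' a r =
        proj₁ (LB.prefactor (proj₂ p) _ _)
          ( proj₂ k , proj₂ q1 , proj₂ q2 , proj₁ h z
          , hf' z a' (LA.emb-coh A.≤-refl (proj₁ q1) (LA.▷-refl a'))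
          , hf z a (LA.emb-coh (proj₁ p) (proj₁ q1) r))
        where z = A.emb (proj₁ q1) a'
      from : f' F.▷ f → f' F.≈ f
      from r = x' , F.≤-refl , p , f' , reflF f' , r

    sameA : ∀ {i} {a' a : A.M i} → a' A.▷ a → a' A.≈ a
    sameA r = proj₂ (LA.prefactor A.≤-refl _ _) r
    sameA' : ∀ {i} {a' a : A.M i} → a' A.≈ a → a' A.▷ a
    sameA' e = proj₁ (LA.prefactor A.≤-refl _ _) e
    sameB : ∀ {i} {a' a : B.M i} → a' B.▷ a → a' B.≈ a
    sameB r = proj₂ (LB.prefactor B.≤-refl _ _) r
    sameB' : ∀ {i} {a' a : B.M i} → a' B.≈ a → a' B.▷ a
    sameB' e = proj₁ (LB.prefactor B.≤-refl _ _) e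

  funCore : CoreLaws funData
  funCore = record
    { ▷-refl    = reflF
    ; prefactor = pfF
    ; emb-≈     = λ p {f} {g} e →
        let r = proj₁ (pfF F.≤-refl f g) e in
        proj₂ (pfF F.≤-refl (F.emb p f) (F.emb p g))
          (λ a' a t → sameB' (LB.emb-≈ (proj₂ p)
                       (sameB (r _ _ (sameA' (LA.proj-≈ (proj₁ p) (sameA t)))))))
    ; proj-≈    = λ p {f} {g} e →
        let r = proj₁ (pfF F.≤-refl f g) e in
        proj₂ (pfF F.≤-refl (F.proj p f) (F.proj p g))
          (λ a' a t → sameB' (LB.proj-≈ (proj₂ p)
                       (sameB (r _ _ (sameA' (LA.emb-≈ (proj₁ p) (sameA t)))))))
    ; emb-coh   = λ p q r a'' a t →
        LB.emb-coh (proj₂ p) (proj₂ q) (r _ _ (LA.proj-coh (proj₁ p) (proj₁ q) t))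
    ; proj-coh  = λ p q r a' a t →
        LB.proj-coh (proj₂ p) (proj₂ q) (r _ _ (LA.emb-coh (proj₁ p) (proj₁ q) t))
    }

funCoreFS : CoreFS → CoreFS → CoreFS
funCoreFS X Y = record
  { dat  = FunSpace.funData (CoreFS.dat X) (CoreFS.dat Y) (CoreFS.pre X) (CoreFS.pre Y)
                            (CoreFS.core X) (CoreFS.core Y)
  ; pre  = FunSpace.funPre (CoreFS.dat X) (CoreFS.dat Y) (CoreFS.pre X) (CoreFS.pre Y)
                           (CoreFS.core X) (CoreFS.core Y)
  ; core = FunSpace.funCore (CoreFS.dat X) (CoreFS.dat Y) (CoreFS.pre X) (CoreFS.pre Y)
                            (CoreFS.core X) (CoreFS.core Y)
  }

propData : FSData
propData = record
  { Idx = ⊤ ; _≤_ = λ _ _ → ⊤ ; ≤-refl = tt ; ≤-trans = λ _ _ → tt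
  ; M = λ _ → Bool ; _▷_ = λ x y → x ≡ y
  ; emb = λ _ → id ; proj = λ _ → id }

propCoreFS : CoreFS
propCoreFS = record
  { dat = propData
  ; pre = record { ≤-irrelevant = λ _ _ → refl ; inhabited = tt
                 ; directed = λ _ _ → tt , tt , tt }
  ; core = record
    { ▷-refl = λ _ → refl
    ; prefactor = λ _ a' a → (λ { (_ , _ , _ , _ , e1 , e2) → trans (sym e1) e2 })
                           , (λ e → tt , tt , tt , a' , refl , e)
    ; emb-≈ = λ _ e → e ; proj-≈ = λ _ e → e
    ; emb-coh = λ _ _ r → r ; proj-coh = λ _ _ r → r }
  }

infixr 5 _⇒_
data Ty (B : Set) : Set where
  prop : Ty B
  base : B → Ty B
  _⇒_  : Ty B → Ty B → Ty B

data Pos {B : Set} : Ty B → Set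
data Neg {B : Set} : Ty B → Set
data Pos {B} where
  pos-prop : Pos prop
  pos-base : ∀ b → Pos (base b)
  pos-⇒    : ∀ {ρ σ} → Neg ρ → Pos σ → Pos (ρ ⇒ σ)
data Neg {B} where
  neg-prop : Neg prop
  neg-⇒    : ∀ {ρ σ} → Pos ρ → Neg σ → Neg (ρ ⇒ σ)

infixl 4 _▸_
data Ctx (B : Set) : Set where
  ε   : Ctx B
  _▸_ : Ctx B → Ty B → Ctx B

data _∋_ {B : Set} : Ctx B → Ty B → Set where
  here  : ∀ {Γ ρ} → (Γ ▸ ρ) ∋ ρ
  there : ∀ {Γ ρ σ} → Γ ∋ ρ → (Γ ▸ σ) ∋ ρ

data Tm {B : Set} : Ctx B → Ty B → Set where
  var : ∀ {Γ ρ} → Γ ∋ ρ → Tm Γ ρ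
  app : ∀ {Γ ρ σ} → Tm Γ (ρ ⇒ σ) → Tm Γ ρ → Tm Γ σ
  lam : ∀ {Γ σ} (ρ : Ty B) → Tm (Γ ▸ ρ) σ → Tm Γ (ρ ⇒ σ)

⟦_⟧C : {B : Set} → Ty B → (B → FactorSystem) → CoreFS
⟦ prop ⟧C   bfs = propCoreFS
⟦ base b ⟧C bfs = toCore (bfs b)
⟦ ρ ⇒ σ ⟧C  bfs = funCoreFS (⟦ ρ ⟧C bfs) (⟦ σ ⟧C bfs)

record Interpretation (B : Set) : Set₁ where
  field
    baseFS     : B → FactorSystem
    baseDirect : ∀ b → IsDirect (FactorSystem.dat (baseFS b))
    arrowRest  : ∀ ρ σ → RestLaws (CoreFS.dat (⟦ ρ ⇒ σ ⟧C baseFS))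

module Sem {B : Set} (𝓘 : Interpretation B) where
  open Interpretation 𝓘

  D : Ty B → FSData
  D ρ = CoreFS.dat (⟦ ρ ⟧C baseFS)

  Idx : Ty B → Set
  Idx ρ = FSData.Idx (D ρ)

  Le : (ρ : Ty B) → Idx ρ → Idx ρ → Set
  Le ρ = FSData._≤_ (D ρ)

  M : (ρ : Ty B) → Idx ρ → Set
  M ρ = FSData.M (D ρ)

  Rel : (ρ : Ty B) {i i' : Idx ρ} → M ρ i' → M ρ i → Set
  Rel ρ {i} {i'} a' a = FSData._▷_ (D ρ) {i} {i'} a' a

  emb : (ρ : Ty B) {i i' : Idx ρ} → Le ρ i i' → M ρ i → M ρ i'
  emb ρ = FSData.emb (D ρ)

  proj : (ρ : Ty B) {i i' : Idx ρ} → Le ρ i i' → M ρ i' → M ρ i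
  proj ρ = FSData.proj (D ρ)

  IdxCtx : Ctx B → Set
  IdxCtx ε       = ⊤
  IdxCtx (Γ ▸ ρ) = IdxCtx Γ × Idx ρ

  Env : (Γ : Ctx B) → IdxCtx Γ → Set
  Env ε       C = ⊤
  Env (Γ ▸ ρ) C = Env Γ (proj₁ C) × M ρ (proj₂ C)

  idxOf : ∀ {Γ ρ} → Γ ∋ ρ → IdxCtx Γ → Idx ρ
  idxOf here      C = proj₂ C
  idxOf (there x) C = idxOf x (proj₁ C)

  lookupEnv : ∀ {Γ ρ} (x : Γ ∋ ρ) {C : IdxCtx Γ} → Env Γ C → M ρ (idxOf x C)
  lookupEnv here      a = proj₂ a
  lookupEnv (there x) a = lookupEnv x (proj₁ a)

  data StJ : ∀ {Γ ρ} → IdxCtx Γ → Tm Γ ρ → Idx ρ → Set where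
    var+ : ∀ {Γ ρ} {C : IdxCtx Γ} (x : Γ ∋ ρ) {j : Idx ρ} →
           Pos ρ → Le ρ (idxOf x C) j → StJ C (var x) j
    var- : ∀ {Γ ρ} {C : IdxCtx Γ} (x : Γ ∋ ρ) {j : Idx ρ} →
           Neg ρ → Le ρ j (idxOf x C) → StJ C (var x) j
    app  : ∀ {Γ ρ σ} {C : IdxCtx Γ} {r : Tm Γ (ρ ⇒ σ)} {s : Tm Γ ρ}
             {i : Idx ρ} {j : Idx σ} →
           StJ C r (i , j) → StJ C s i → StJ C (app r s) j
    abs  : ∀ {Γ ρ σ} {C : IdxCtx Γ} {r : Tm (Γ ▸ ρ) σ} {i : Idx ρ} {j : Idx σ} →
           StJ (C , i) r j → StJ C (lam ρ r) (i , j)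

  data Val : ∀ {Γ ρ} {C : IdxCtx Γ} {r : Tm Γ ρ} {j : Idx ρ} →
             StJ C r j → Env Γ C → M ρ j → Set where
    val-var+ : ∀ {Γ ρ} {C : IdxCtx Γ} {x : Γ ∋ ρ} {j} {pos : Pos ρ}
                 {p : Le ρ (idxOf x C) j} {a : Env Γ C} →
               Val (var+ x pos p) a (emb ρ p (lookupEnv x a))
    val-var- : ∀ {Γ ρ} {C : IdxCtx Γ} {x : Γ ∋ ρ} {j} {neg : Neg ρ}
                 {p : Le ρ j (idxOf x C)} {a : Env Γ C} →
               Val (var- x neg p) a (proj ρ p (lookupEnv x a))
    val-app  : ∀ {Γ ρ σ} {C : IdxCtx Γ} {r : Tm Γ (ρ ⇒ σ)} {s : Tm Γ ρ}
                 {i : Idx ρ} {j : Idx σ} {d : StJ C r (i , j)} {e : StJ C s i}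
                 {a : Env Γ C} {f : M (ρ ⇒ σ) (i , j)} {b : M ρ i} →
               Val d a f → Val e a b → Val (app d e) a (proj₁ f b)
    val-abs  : ∀ {Γ ρ σ} {C : IdxCtx Γ} {r : Tm (Γ ▸ ρ) σ} {i : Idx ρ} {j : Idx σ}
                 {d : StJ (C , i) r j} {a : Env Γ C} (f : M (ρ ⇒ σ) (i , j)) →
               (∀ (b : M ρ i) → Val d (a , b) (proj₁ f b)) → Val (abs d) a f

{-# OPTIONS --safe #-}
-- Two derivations of r : C ⊢ i and r : C ⊢ i' may give the subterms of r
-- unrelated indices, whereas ▷ only compares comparable levels.  So we pass
-- to the hereditary extension of ▷ to arbitrary pairs of levels (≈ at base
-- types, equality at prop, related arguments to related results at arrow
-- types), which agrees with ▷ on comparable levels.  Embeddings at positive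
-- and projections at negative types preserve it (at base types because the
-- base factor systems are direct), so a logical-relations argument over two
-- derivations relates their state values.  Applied to a single derivation,
-- the same argument shows that the state value of an abstraction preserves
-- ≈, which is what makes state values exist.
module Submission where

open import Defs
open import Data.Product using (Σ; Σ-syntax; _×_; _,_; proj₁; proj₂)
open import Data.Unit using (⊤; tt)
open import Relation.Binary.PropositionalEquality using (_≡_; subst)

module CoreLawProperties (X : FSData) (L : CoreLaws X) where
  open FSData X
  open CoreLaws L

  ≈-sym : ∀ {i j} {x : M i} {y : M j} → x ≈ y → y ≈ x
  ≈-sym (k , p , q , c , c▷x , c▷y) = k , q , p , c , c▷y , c▷x

  ≈⇒▷ : ∀ {i} {x y : M i} → x ≈ y → x ▷ y
  ≈⇒▷ = proj₁ (prefactor ≤-refl _ _)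

  ▷⇒≈ : ∀ {i} {x y : M i} → x ▷ y → x ≈ y
  ▷⇒≈ = proj₂ (prefactor ≤-refl _ _)

  ≈-trans : ∀ {i} {x y z : M i} → x ≈ y → y ≈ z → x ≈ z
  ≈-trans {i} {y = y} x≈y y≈z = i , ≤-refl , ≤-refl , y , ≈⇒▷ (≈-sym x≈y) , ≈⇒▷ y≈z

module DirectProperties (F : FactorSystem) (direct : IsDirect (FactorSystem.dat F)) where
  open FactorSystem F
  open FSData dat
  open IsDirectedPreorder pre
  open CoreLaws core
  open RestLaws rest
  open CoreLawProperties dat core

  emb∘emb-≈ : ∀ {k i i' n} (p : k ≤ i) (q : i ≤ n) (p' : k ≤ i') (q' : i' ≤ n) (a : M k) →
              emb q (emb p a) ≈ emb q' (emb p' a)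
  emb∘emb-≈ p q p' q' a =
    ≈-trans (emb-comp p q a)
      (subst (λ r → emb r a ≈ emb q' (emb p' a))
             (≤-irrelevant (≤-trans p' q') (≤-trans p q))
             (≈-sym (emb-comp p' q' a)))

  emb-▷-emb : ∀ {k i l n} (p : k ≤ i) (q : i ≤ n) (kl : k ≤ l) (ln : l ≤ n) {c : M l} {a : M k} →
              c ▷ a → emb ln c ▷ emb p a
  emb-▷-emb p q kl ln {c} {a} c▷a =
    proj₂ (direct q (emb ln c) (emb p a))
      (≈-trans (emb-≈ ln (proj₁ (direct kl c a) c▷a)) (emb∘emb-≈ kl ln p q a))

  emb-≈-emb : ∀ {k k' i i'} (p : k ≤ i) (p' : k' ≤ i') {a : M k} {a' : M k'} →
              a' ≈ a → emb p' a' ≈ emb p a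
  emb-≈-emb {i = i} {i'} p p' (l , k'≤l , k≤l , c , c▷a' , c▷a) =
    let (n , i≤n , i'≤n) = directed i i'
        (m , n≤m , l≤m) = directed n l
    in m , ≤-trans i'≤n n≤m , ≤-trans i≤n n≤m , emb l≤m c
       , emb-▷-emb p' (≤-trans i'≤n n≤m) k'≤l l≤m c▷a'
       , emb-▷-emb p (≤-trans i≤n n≤m) k≤l l≤m c▷a

module LogicalRelation {B : Set} (𝓘 : Interpretation B) where
  open Interpretation 𝓘
  open Sem 𝓘

  private
    ≤-refl : (ρ : Ty B) {i : Idx ρ} → Le ρ i i
    ≤-refl ρ = FSData.≤-refl (D ρ)

    module Laws (ρ : Ty B) where
      open CoreLaws (CoreFS.core (⟦ ρ ⟧C baseFS)) public
      open CoreLawProperties (D ρ) (CoreFS.core (⟦ ρ ⟧C baseFS)) public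

  Approx : (ρ : Ty B) {i j : Idx ρ} → M ρ i → M ρ j → Set
  Approx ρ = FSData._≈_ (D ρ)

  HRel : (ρ : Ty B) {i i' : Idx ρ} → M ρ i' → M ρ i → Set
  HRel prop     x' x = x' ≡ x
  HRel (base b) x' x = Approx (base b) x' x
  HRel (ρ ⇒ σ)  f' f = ∀ b' b → HRel ρ b' b → HRel σ (proj₁ f' b') (proj₁ f b)

  HRel⇒Rel : (ρ : Ty B) {i i' : Idx ρ} → Le ρ i i' → {x' : M ρ i'} {x : M ρ i} →
             HRel ρ x' x → Rel ρ x' x
  Rel⇒HRel : (ρ : Ty B) {i i' : Idx ρ} → Le ρ i i' → {x' : M ρ i'} {x : M ρ i} →
             Rel ρ x' x → HRel ρ x' x
  HRel⇒Rel prop     _ x'≡x = x'≡x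
  HRel⇒Rel (base b) p x'≈x = proj₁ (Laws.prefactor (base b) p _ _) x'≈x
  HRel⇒Rel (ρ ⇒ σ) (p , q) f'~f b' b b'▷b = HRel⇒Rel σ q (f'~f b' b (Rel⇒HRel ρ p b'▷b))
  Rel⇒HRel prop     _ x'≡x = x'≡x
  Rel⇒HRel (base b) p x'▷x = proj₂ (Laws.prefactor (base b) p _ _) x'▷x
  Rel⇒HRel (ρ ⇒ σ) (p , q) f'▷f b' b b'~b = Rel⇒HRel σ q (f'▷f b' b (HRel⇒Rel ρ p b'~b))

  HRel-refl : (ρ : Ty B) {i : Idx ρ} (x : M ρ i) → HRel ρ x x
  HRel-refl ρ x = Rel⇒HRel ρ (≤-refl ρ) (Laws.▷-refl ρ x)

  ≈⇒HRel : (ρ : Ty B) {i : Idx ρ} {x y : M ρ i} → Approx ρ x y → HRel ρ x y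
  ≈⇒HRel ρ x≈y = Rel⇒HRel ρ (≤-refl ρ) (Laws.≈⇒▷ ρ x≈y)

  HRel⇒≈ : (ρ : Ty B) {i : Idx ρ} {x y : M ρ i} → HRel ρ x y → Approx ρ x y
  HRel⇒≈ ρ x~y = Laws.▷⇒≈ ρ (HRel⇒Rel ρ (≤-refl ρ) x~y)

  emb-HRel : ∀ {ρ} → Pos ρ → ∀ {k k' i i'} (p : Le ρ k i) (p' : Le ρ k' i')
             {a : M ρ k} {a' : M ρ k'} → HRel ρ a' a → HRel ρ (emb ρ p' a') (emb ρ p a)
  proj-HRel : ∀ {ρ} → Neg ρ → ∀ {k k' i i'} (p : Le ρ i k) (p' : Le ρ i' k')
              {a : M ρ k} {a' : M ρ k'} → HRel ρ a' a → HRel ρ (proj ρ p' a') (proj ρ p a)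
  emb-HRel pos-prop     _ _ a'≡a = a'≡a
  emb-HRel (pos-base b) p p' a'≈a = DirectProperties.emb-≈-emb (baseFS b) (baseDirect b) p p' a'≈a
  emb-HRel (pos-⇒ ρ⁻ σ⁺) (p , q) (p' , q') f'~f b' b b'~b =
    emb-HRel σ⁺ q q' (f'~f _ _ (proj-HRel ρ⁻ p p' b'~b))
  proj-HRel neg-prop _ _ a'≡a = a'≡a
  proj-HRel (neg-⇒ ρ⁺ σ⁻) (p , q) (p' , q') f'~f b' b b'~b =
    proj-HRel σ⁻ q q' (f'~f _ _ (emb-HRel ρ⁺ p p' b'~b))

  -- Only types built from prop alone are both positive and negative.
  emb-proj-HRel : ∀ {ρ} → Pos ρ → Neg ρ → ∀ {k k' i i'} (p : Le ρ i k) (p' : Le ρ k' i')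
                  {a : M ρ k} {a' : M ρ k'} → HRel ρ a' a → HRel ρ (emb ρ p' a') (proj ρ p a)
  proj-emb-HRel : ∀ {ρ} → Pos ρ → Neg ρ → ∀ {k k' i i'} (p : Le ρ k i) (p' : Le ρ i' k')
                  {a : M ρ k} {a' : M ρ k'} → HRel ρ a' a → HRel ρ (proj ρ p' a') (emb ρ p a)
  emb-proj-HRel pos-prop neg-prop _ _ a'≡a = a'≡a
  emb-proj-HRel (pos-⇒ ρ⁻ σ⁺) (neg-⇒ ρ⁺ σ⁻) (p , q) (p' , q') f'~f b' b b'~b =
    emb-proj-HRel σ⁺ σ⁻ q q' (f'~f _ _ (proj-emb-HRel ρ⁺ ρ⁻ p p' b'~b))
  proj-emb-HRel pos-prop neg-prop _ _ a'≡a = a'≡a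
  proj-emb-HRel (pos-⇒ ρ⁻ σ⁺) (neg-⇒ ρ⁺ σ⁻) (p , q) (p' , q') f'~f b' b b'~b =
    proj-emb-HRel σ⁺ σ⁻ q q' (f'~f _ _ (emb-proj-HRel ρ⁺ ρ⁻ p p' b'~b))

  HRelEnv : (Γ : Ctx B) {C C' : IdxCtx Γ} → Env Γ C' → Env Γ C → Set
  HRelEnv ε       _ _ = ⊤
  HRelEnv (Γ ▸ ρ) (a' , b') (a , b) = HRelEnv Γ a' a × HRel ρ b' b

  HRelEnv-refl : (Γ : Ctx B) {C : IdxCtx Γ} (a : Env Γ C) → HRelEnv Γ a a
  HRelEnv-refl ε       _       = tt
  HRelEnv-refl (Γ ▸ ρ) (a , b) = HRelEnv-refl Γ a , HRel-refl ρ b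

  lookupEnv-HRel : ∀ {Γ ρ} (x : Γ ∋ ρ) {C C' : IdxCtx Γ} {a' : Env Γ C'} {a : Env Γ C} →
                   HRelEnv Γ a' a → HRel ρ (lookupEnv x a') (lookupEnv x a)
  lookupEnv-HRel here      (_ , b'~b) = b'~b
  lookupEnv-HRel (there x) (a'~a , _) = lookupEnv-HRel x a'~a

  fundamental : ∀ {Γ ρ} {r : Tm Γ ρ} {C C' : IdxCtx Γ} {i i' : Idx ρ}
                {d : StJ C r i} {d' : StJ C' r i'} {a : Env Γ C} {a' : Env Γ C'}
                {v : M ρ i} {v' : M ρ i'} →
                Val d' a' v' → Val d a v → HRelEnv Γ a' a → HRel ρ v' v
  fundamental (val-var+ {x = x} {pos = pos} {p = p'}) (val-var+ {p = p}) a'~a =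
    emb-HRel pos p p' (lookupEnv-HRel x a'~a)
  fundamental (val-var- {x = x} {neg = neg} {p = p'}) (val-var- {p = p}) a'~a =
    proj-HRel neg p p' (lookupEnv-HRel x a'~a)
  fundamental (val-var+ {x = x} {pos = pos} {p = p'}) (val-var- {neg = neg} {p = p}) a'~a =
    emb-proj-HRel pos neg p p' (lookupEnv-HRel x a'~a)
  fundamental (val-var- {x = x} {neg = neg} {p = p'}) (val-var+ {pos = pos} {p = p}) a'~a =
    proj-emb-HRel pos neg p p' (lookupEnv-HRel x a'~a)
  fundamental (val-app f' b') (val-app f b) a'~a =
    fundamental f' f a'~a _ _ (fundamental b' b a'~a)
  fundamental (val-abs _ f') (val-abs _ f) a'~a b' b b'~b =
    fundamental (f' b') (f b) (a'~a , b'~b)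

  eval : ∀ {Γ ρ} {C : IdxCtx Γ} {r : Tm Γ ρ} {j : Idx ρ} (d : StJ C r j) (a : Env Γ C) →
         Σ[ v ∈ M ρ j ] Val d a v
  eval (var+ _ _ _) a = _ , val-var+
  eval (var- _ _ _) a = _ , val-var-
  eval (app d e) a =
    let (f , f-val) = eval d a
        (b , b-val) = eval e a
    in proj₁ f b , val-app f-val b-val
  eval {Γ} {ρ ⇒ σ} (abs {i = i} {j = j} d) a = (g , g-≈) , val-abs (g , g-≈) g-val
    where
    g : M ρ i → M σ j
    g b = proj₁ (eval d (a , b))
    g-val : ∀ b → Val d (a , b) (g b)
    g-val b = proj₂ (eval d (a , b))
    g-≈ : ∀ {b c} → Approx ρ b c → Approx σ (g b) (g c)
    g-≈ b≈c = HRel⇒≈ σ (fundamental (g-val _) (g-val _) (HRelEnv-refl Γ a , ≈⇒HRel ρ b≈c))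

corollary3p10 : (B : Set) (𝓘 : Interpretation B) →
    let open Sem 𝓘 in
    ∀ {Γ : Ctx B} {ρ : Ty B} (r : Tm Γ ρ) (C : IdxCtx Γ) {i i' : Idx ρ} →
      Le ρ i i' → (d : StJ C r i) (d' : StJ C r i') (a : Env Γ C) →
      (Σ[ v ∈ M ρ i ] Val d a v) × (Σ[ v' ∈ M ρ i' ] Val d' a v') ×
      (∀ (v : M ρ i) (v' : M ρ i') → Val d a v → Val d' a v' → Rel ρ v' v)
corollary3p10 B 𝓘 {Γ} {ρ} r C i≤i' d d' a =
  eval d a , eval d' a ,
  λ v v' v-val v'-val → HRel⇒Rel ρ i≤i' (fundamental v'-val v-val (HRelEnv-refl Γ a))
  where open LogicalRelation 𝓘
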